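{- Let $q\ge2$ and $n\ge1$ be integers. Under each of the scenarios $(*\bullet)$ and $(\bullet\bullet)$, the set $\mathcal{F}_q$ of all functions $[q\rangle\to\{0,1\}$ is $n$-cell implementable if and only if $q\le 2n$.
   Context: $[b\rangle=\{0,1,\ldots,b-1\}$. Let $\mathbb{B}=\{0,1\}$, $\mathbb{B}_\circ=\mathbb{B}$, $\mathbb{B}_*=\mathbb{B}\cup\{*\}$, $\mathbb{B}_\bullet=\mathbb{B}\cup\{*,\bullet\}$. Define $\mathrm{T}:\mathbb{B}_\bullet^2\to\mathbb{B}$ by $\mathrm{T}(u,\vartheta)=1$ if and only if $u=*$, or $\vartheta=*$, or $u=\vartheta\in\mathbb{B}$. $\mathcal{F}_q$ is the set of all functions $[q\rangle\to\mathbb{B}$. For $\alpha,\beta\in\{\circ,*,\bullet\}$, a subset $\Phi\subseteq\mathcal{F}_q$ is $n$-cell implementable under scenario $(\alpha\beta)$ if there exist mappings $\mathbf{u}=(u_j)_{j\in[n\rangle}:[q\rangle\to\mathbb{B}_\alpha^n$ and $\boldsymbol{\vartheta}=(\vartheta_j)_{j\in[n\rangle}:\Phi\to\mathbb{B}_\beta^n$ such that $f(x)=\bigwedge_{j\in[n\rangle}\mathrm{T}(u_j(x),\vartheta_j(f))$ for all $f\in\Phi$ and $x\in[q\rangle$. -}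

module Defs where

open import Data.Nat using (ℕ)
open import Data.Fin using (Fin)
open import Data.Bool using (Bool; true; false; _∧_)
open import Data.Product using (Σ; ∃; _×_)
open import Data.Unit using (⊤)
open import Relation.Binary.PropositionalEquality using (_≡_)

data B• : Set where
  b0 b1 star bullet : B•

data Scn : Set where
  ∘ₛ *ₛ •ₛ : Scn

data B∘ : Set where
  c0 c1 : B∘

data B* : Set where
  s0 s1 sstar : B*

Alph : Scn → Set
Alph ∘ₛ = B∘
Alph *ₛ = B*
Alph •ₛ = B•

embed : (α : Scn) → Alph α → B•
embed ∘ₛ c0 = b0
embed ∘ₛ c1 = b1
embed *ₛ s0 = b0
embed *ₛ s1 = b1
embed *ₛ sstar = star
embed •ₛ x = x

T : B• → B• → Bool
T star _ = true
T b0 star = true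
T b1 star = true
T bullet star = true
T b0 b0 = true
T b1 b1 = true
T _ _ = false

bigAnd : (n : ℕ) → (Fin n → Bool) → Bool
bigAnd ℕ.zero g = true
bigAnd (ℕ.suc n) g = g Fin.zero ∧ bigAnd n (λ j → g (Fin.suc j))

Fun : ℕ → Set
Fun q = Fin q → Bool

-- Φ ⊆ 𝓕_q is n-cell implementable under scenario (αβ).
-- Φ is given as a predicate on 𝓕_q; ϑ is defined on elements of Φ.
Implementable : (α β : Scn) (q n : ℕ) (Φ : Fun q → Set) → Set
Implementable α β q n Φ =
  Σ (Fin q → Fin n → Alph α) λ u →
  Σ ((f : Fun q) → Φ f → Fin n → Alph β) λ ϑ →
    (f : Fun q) (p : Φ f) (x : Fin q) →
      f x ≡ bigAnd n (λ j → T (embed α (u x j)) (embed β (ϑ f p j)))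

AllFuns : (q : ℕ) → Fun q → Set
AllFuns q f = ⊤

{-# OPTIONS --safe #-}
-- If the function vanishing only at x is implemented, some cell j fails at x and
-- passes at every y ≠ x.  Two points x ≠ y failing in the same cell force both of
-- their symbols there to be bits (each must pass the other's ϑ, which is not *), and
-- these bits differ, so x ↦ (bit, cell) is injective and q ≤ 2n.  Conversely a cell
-- carrying * for all but two points and the bits 0, 1 for those two can produce any
-- pair of values with ϑ ∈ {*, 0, 1, •}, so 2n points suffice.
module Submission where

open import Defs
open import Data.Bool using (Bool; true; false; not)
open import Data.Bool.Properties using (¬-not)
open import Data.Empty using (⊥-elim)
open import Data.Fin using (Fin; zero; suc; toℕ; fromℕ<; inject≤; combine; remQuot; _≟_)
open import Data.Fin.Properties
  using (toℕ-injective; toℕ-fromℕ<; toℕ-inject≤; toℕ<n; combine-injective; combine-remQuot; injective⇒≤)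
open import Data.Nat using (ℕ; _≤_; _*_; _<_; _<?_)
open import Data.Product using (_×_; _,_; proj₁; proj₂; ∃)
open import Function.Base using (_∘_; case_of_)
open import Function.Bundles using (_⇔_; mk⇔)
open import Function.Definitions using (Injective)
open import Relation.Nullary using (Dec; yes; no; does)
open import Relation.Nullary.Decidable using (dec-true; dec-false)
open import Relation.Binary.PropositionalEquality

bigAnd-true⇒ : ∀ n (g : Fin n → Bool) → bigAnd n g ≡ true → ∀ j → g j ≡ true
bigAnd-true⇒ (ℕ.suc n) g p j with g zero in g₀
bigAnd-true⇒ (ℕ.suc n) g p zero    | true = g₀
bigAnd-true⇒ (ℕ.suc n) g p (suc j) | true = bigAnd-true⇒ n (g ∘ suc) p j

bigAnd-true⇐ : ∀ n (g : Fin n → Bool) → (∀ j → g j ≡ true) → bigAnd n g ≡ true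
bigAnd-true⇐ ℕ.zero    g all = refl
bigAnd-true⇐ (ℕ.suc n) g all rewrite all zero = bigAnd-true⇐ n (g ∘ suc) (all ∘ suc)

bigAnd-false⇒ : ∀ n (g : Fin n → Bool) → bigAnd n g ≡ false → ∃ λ j → g j ≡ false
bigAnd-false⇒ (ℕ.suc n) g p with g zero in g₀
... | false = zero , g₀
... | true  = let j , gj = bigAnd-false⇒ n (g ∘ suc) p in suc j , gj

bigAnd-≡-at : ∀ n (g : Fin n → Bool) (c : Fin n) →
              (∀ j → j ≢ c → g j ≡ true) → bigAnd n g ≡ g c
bigAnd-≡-at n g c others with g c in gc
... | true  = bigAnd-true⇐ n g λ j → true-at j (j ≟ c)
  where
  true-at : ∀ j → Dec (j ≡ c) → g j ≡ true
  true-at j (yes refl) = gc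
  true-at j (no j≢c)   = others j j≢c
... | false = ¬-not λ all → case trans (sym gc) (bigAnd-true⇒ n g all c) of λ ()

data Bit : B• → Set where
  bit0 : Bit b0
  bit1 : Bit b1

T-false⇒left≢star : ∀ {a v} → T a v ≡ false → a ≢ star
T-false⇒left≢star {star} ()
T-false⇒left≢star {b0}     _ ()
T-false⇒left≢star {b1}     _ ()
T-false⇒left≢star {bullet} _ ()

T-false⇒right≢star : ∀ {a v} → T a v ≡ false → v ≢ star
T-false⇒right≢star {star} ()
T-false⇒right≢star {b0}     {star} ()
T-false⇒right≢star {b1}     {star} ()
T-false⇒right≢star {bullet} {star} ()
T-false⇒right≢star {v = b0}     _ ()
T-false⇒right≢star {v = b1}     _ ()
T-false⇒right≢star {v = bullet} _ ()

T-true⇒Bit : ∀ {a v} → a ≢ star → v ≢ star → T a v ≡ true → Bit a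
T-true⇒Bit {star}   a≢* _ _ = ⊥-elim (a≢* refl)
T-true⇒Bit {b0}     _ _ _ = bit0
T-true⇒Bit {b1}     _ _ _ = bit1
T-true⇒Bit {bullet} {star}   _ v≢* _ = ⊥-elim (v≢* refl)
T-true⇒Bit {bullet} {b0}     _ _ ()
T-true⇒Bit {bullet} {b1}     _ _ ()
T-true⇒Bit {bullet} {bullet} _ _ ()

tag : B• → Fin 2
tag b1 = suc zero
tag _  = zero

tag-injective-on-Bit : ∀ {a c} → Bit a → Bit c → tag a ≡ tag c → a ≡ c
tag-injective-on-Bit bit0 bit0 _ = refl
tag-injective-on-Bit bit1 bit1 _ = refl
tag-injective-on-Bit bit0 bit1 ()
tag-injective-on-Bit bit1 bit0 ()

tag-separates : ∀ {a c v w} → T a v ≡ false → T c v ≡ true → T c w ≡ false → T a w ≡ true →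
                tag a ≢ tag c
tag-separates {a} {c} {v} {w} Tav Tcv Tcw Taw tag≡ =
  case trans (sym Tav) (subst (λ s → T s v ≡ true) (sym a≡c) Tcv) of λ ()
  where
  a≡c : a ≡ c
  a≡c = tag-injective-on-Bit
    (T-true⇒Bit (T-false⇒left≢star Tav) (T-false⇒right≢star Tcw) Taw)
    (T-true⇒Bit (T-false⇒left≢star Tcw) (T-false⇒right≢star Tav) Tcv)
    tag≡

zeroOnlyAt : ∀ {q} → Fin q → Fun q
zeroOnlyAt x y = not (does (x ≟ y))

zeroOnlyAt-self : ∀ {q} (x : Fin q) → zeroOnlyAt x x ≡ false
zeroOnlyAt-self x = cong not (dec-true (x ≟ x) refl)

zeroOnlyAt-other : ∀ {q} {x y : Fin q} → x ≢ y → zeroOnlyAt x y ≡ true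
zeroOnlyAt-other {x = x} {y} x≢y = cong not (dec-false (x ≟ y) x≢y)

module Necessity {q n : ℕ} {Φ : Fun q → Set} (Φ-zeroOnlyAt : ∀ x → Φ (zeroOnlyAt x))
                 (I : Implementable •ₛ •ₛ q n Φ) where

  u : Fin q → Fin n → B•
  u = proj₁ I

  ϑ : Fin q → Fin n → B•
  ϑ x = proj₁ (proj₂ I) (zeroOnlyAt x) (Φ-zeroOnlyAt x)

  implements : ∀ x y → zeroOnlyAt x y ≡ bigAnd n (λ j → T (u y j) (ϑ x j))
  implements x = proj₂ (proj₂ I) (zeroOnlyAt x) (Φ-zeroOnlyAt x)

  failing : ∀ x → ∃ λ j → T (u x j) (ϑ x j) ≡ false
  failing x = bigAnd-false⇒ n _ (trans (sym (implements x x)) (zeroOnlyAt-self x))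

  cell : Fin q → Fin n
  cell = proj₁ ∘ failing

  passing : ∀ {x y} → x ≢ y → ∀ j → T (u y j) (ϑ x j) ≡ true
  passing {x} {y} x≢y = bigAnd-true⇒ n _ (trans (sym (implements x y)) (zeroOnlyAt-other x≢y))

  address : Fin q → Fin (2 * n)
  address x = combine (tag (u x (cell x))) (cell x)

  address-injective : Injective _≡_ _≡_ address
  address-injective {x} {y} same with x ≟ y
  ... | yes x≡y = x≡y
  ... | no x≢y with combine-injective _ _ _ _ same
  ...   | tag≡ , cell≡ = ⊥-elim (tag-separates
          (proj₂ (failing x))
          (passing x≢y (cell x))
          (subst (λ j → T (u y j) (ϑ y j) ≡ false) (sym cell≡) (proj₂ (failing y)))
          (passing (x≢y ∘ sym) (cell x))
          (trans tag≡ (cong (tag ∘ u y) (sym cell≡))))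

  q≤2n : q ≤ 2 * n
  q≤2n = injective⇒≤ address-injective

bitSymbol : Fin 2 → B*
bitSymbol zero       = s0
bitSymbol (suc zero) = s1

encode : Bool → Bool → B•
encode true  true  = star
encode true  false = b0
encode false true  = b1
encode false false = bullet

T-b0-encode : ∀ a b → T b0 (encode a b) ≡ a
T-b0-encode true  true  = refl
T-b0-encode true  false = refl
T-b0-encode false true  = refl
T-b0-encode false false = refl

T-b1-encode : ∀ a b → T b1 (encode a b) ≡ b
T-b1-encode true  true  = refl
T-b1-encode true  false = refl
T-b1-encode false true  = refl
T-b1-encode false false = refl

T-bitSymbol-encode : ∀ (g : Fin 2 → Bool) r →
                     T (embed *ₛ (bitSymbol r)) (encode (g zero) (g (suc zero))) ≡ g r
T-bitSymbol-encode g zero       = T-b0-encode (g zero) (g (suc zero))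
T-bitSymbol-encode g (suc zero) = T-b1-encode (g zero) (g (suc zero))

padTrue : ∀ {q m} → Fun q → Fun m
padTrue {q} f i with toℕ i <? q
... | yes i<q = f (fromℕ< i<q)
... | no _    = true

padTrue-inject≤ : ∀ {q m} (f : Fun q) (x : Fin q) (q≤m : q ≤ m) → padTrue f (inject≤ x q≤m) ≡ f x
padTrue-inject≤ {q} f x q≤m with toℕ (inject≤ x q≤m) <? q
... | yes i<q = cong f (toℕ-injective (trans (toℕ-fromℕ< i<q) (toℕ-inject≤ x q≤m)))
... | no i≮q  = ⊥-elim (i≮q (subst (_< q) (sym (toℕ-inject≤ x q≤m)) (toℕ<n x)))

module Sufficiency {q n : ℕ} (q≤2n : q ≤ 2 * n) where

  bit : Fin q → Fin 2
  bit x = proj₁ (remQuot {2} n (inject≤ x q≤2n))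

  cell : Fin q → Fin n
  cell x = proj₂ (remQuot {2} n (inject≤ x q≤2n))

  u : Fin q → Fin n → B*
  u x j with j ≟ cell x
  ... | yes _ = bitSymbol (bit x)
  ... | no _  = sstar

  ϑ : Fun q → Fin n → B•
  ϑ f j = encode (padTrue f (combine {2} zero j)) (padTrue f (combine {2} (suc zero) j))

  T-off-cell : ∀ f x j → j ≢ cell x → T (embed *ₛ (u x j)) (ϑ f j) ≡ true
  T-off-cell f x j j≢c with j ≟ cell x
  ... | yes j≡c = ⊥-elim (j≢c j≡c)
  ... | no _    = refl

  T-on-cell : ∀ f x → T (embed *ₛ (u x (cell x))) (ϑ f (cell x)) ≡ f x
  T-on-cell f x with cell x ≟ cell x
  ... | no c≢c = ⊥-elim (c≢c refl)
  ... | yes _  = begin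
    T (embed *ₛ (bitSymbol (bit x))) (ϑ f (cell x)) ≡⟨ T-bitSymbol-encode (λ r → padTrue f (combine r (cell x))) (bit x) ⟩
    padTrue f (combine (bit x) (cell x))             ≡⟨ cong (padTrue f) (combine-remQuot {2} n (inject≤ x q≤2n)) ⟩
    padTrue f (inject≤ x q≤2n)                       ≡⟨ padTrue-inject≤ f x q≤2n ⟩
    f x                                              ∎
    where open ≡-Reasoning

  implementable : (Φ : Fun q → Set) → Implementable *ₛ •ₛ q n Φ
  implementable Φ = u , (λ f _ → ϑ f) , λ f _ x →
    sym (trans (bigAnd-≡-at n _ (cell x) (T-off-cell f x)) (T-on-cell f x))

star⇒bullet : ∀ {β q n Φ} → Implementable *ₛ β q n Φ → Implementable •ₛ β q n Φ
star⇒bullet (u , ϑ , implements) = (λ x j → embed *ₛ (u x j)) , ϑ , implements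

proposition15 : (q n : ℕ) → 2 ≤ q → 1 ≤ n →
    (Implementable *ₛ •ₛ q n (AllFuns q) ⇔ q ≤ 2 * n)
    × (Implementable •ₛ •ₛ q n (AllFuns q) ⇔ q ≤ 2 * n)
proposition15 q n _ _ =
  mk⇔ (necessary ∘ star⇒bullet) sufficient , mk⇔ necessary (star⇒bullet ∘ sufficient)
  where
  necessary : Implementable •ₛ •ₛ q n (AllFuns q) → q ≤ 2 * n
  necessary = Necessity.q≤2n _

  sufficient : q ≤ 2 * n → Implementable *ₛ •ₛ q n (AllFuns q)
  sufficient q≤2n = Sufficiency.implementable q≤2n (AllFuns q)
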